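{- Consider any execution of pdqsort (as described in the context) and a distinct value $v$. The second time (in execution order) that an element comparing equal to $v$ is selected as a pivot, all elements of the input comparing equal to $v$ are in their correct (final sorted) positions, and no subsequent recursive call operates on a subarray containing any of them.
   Context: Setting. The input is an array $A[0..n-1]$ of elements compared by a strict weak ordering $<$; $a,b$ compare equal if neither $a<b$ nor $b<a$ (an equivalence relation whose classes are called distinct values); $a\le b$ means "not $b<a$". pdqsort is the following recursive procedure acting in place on contiguous subarrays $A[a..b)=(A[a],\dots,A[b-1])$, each call carrying an integer counter $t$; the top-level call is on $A[0..n)$ with $t=\lfloor\log_2 n\rfloor$. A subarray $A[a..b)$ is leftmost if $a=0$; otherwise its predecessor is the element currently at position $a-1$. Fixed constants are an insertion-sort threshold $c\ge3$, a parameter $p\in(0,1)$, and a constant move bound. A call on $A[a..b)$ with $m=b-a$ does: (1) if $m\le c$, insertion sort $A[a..b)$ and return; (2) if $t=0$, heapsort $A[a..b)$ and return; (3) select a pivot $q$ as the median of at least three sampled elements of $A[a..b)$ by a deterministic rule, and move it to position $a$; (4) if $a>0$ and the predecessor compares equal to $q$, apply partition_left: rearrange $A[a..b)$ so that $q$ ends at a position $r$, all elements of $A[a..r)$ are $\le q$ and all elements of $A[r+1..b)$ are $>q$; otherwise apply partition_right: rearrange so that $q$ ends at a position $r$, all elements of $A[a..r)$ are $<q$ and all of $A[r+1..b)$ are $\ge q$; (5) the partition is bad if $\min(r-a,b-r-1)<pm$; if bad, set $t:=t-1$ and swap $O(1)$ elements at fixed relative positions inside each of the two parts; (6) if partition_right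 was applied, the partition is not bad, and no element other than the pivot was moved, run on both parts an insertion sort that aborts after the constant number of moves; if both complete, return; (7) if partition_left was applied, recurse only on $A[r+1..b)$; otherwise recurse on $A[a..r)$ and then on $A[r+1..b)$, each with counter $t$.
   Formalization: The parameter p of the bad-partition test is a rational number in (0,1). -}

module Defs where

open import Level using (Level; _⊔_) renaming (suc to lsuc)
open import Data.Nat using (ℕ; zero; suc; _+_; _*_; _∸_; _≤_; _<_; _⊓_)
open import Data.Nat.Logarithm using (⌊log₂_⌋)
open import Data.List using (List; []; _∷_; _++_; length; take; drop; mapMaybe)
open import Data.List.Relation.Unary.All using (All)
open import Data.List.Relation.Unary.AllPairs using (AllPairs)
open import Data.List.Relation.Unary.Unique.Propositional using (Unique)
open import Data.List.Relation.Binary.Permutation.Propositional using (_↭_)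
open import Data.Maybe using (Maybe; just; nothing)
open import Data.Product using (Σ; _×_; _,_)
open import Relation.Binary.Core using (Rel)
open import Relation.Binary.PropositionalEquality using (_≡_; _≢_)
open import Relation.Nullary using (¬_)
open import Data.Empty.Polymorphic using (⊥)
open import Data.Unit.Polymorphic using (⊤)

record IsStrictWeakOrder {a ℓ} {A : Set a} (_<_ : Rel A ℓ) : Set (a ⊔ ℓ) where
  field
    irrefl      : ∀ {x} → ¬ (x < x)
    trans       : ∀ {x y z} → x < y → y < z → x < z
    incomp-trans : ∀ {x y z} → (¬ (x < y) × ¬ (y < x)) → (¬ (y < z) × ¬ (z < y))
                 → (¬ (x < z) × ¬ (z < x))

-- The fixed data of the setting: elements with a strict weak ordering,
-- the insertion-sort threshold c ≥ 3, and p = pn / pd ∈ (0,1).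
record Setting (a ℓ : Level) : Set (lsuc (a ⊔ ℓ)) where
  field
    A       : Set a
    _≺_     : Rel A ℓ
    isSWO   : IsStrictWeakOrder _≺_
    c       : ℕ
    3≤c     : 3 ≤ c
    pn pd   : ℕ
    0<pn    : 0 < pn
    pn<pd   : pn < pd

module Semantics {a ℓ} (S : Setting a ℓ) where
  open Setting S

  _≈_ : A → A → Set ℓ
  x ≈ y = ¬ (x ≺ y) × ¬ (y ≺ x)

  _≼_ : A → A → Set ℓ
  x ≼ y = ¬ (y ≺ x)

  _‼_ : List A → ℕ → Maybe A
  []       ‼ _       = nothing
  (x ∷ xs) ‼ zero    = just x
  (x ∷ xs) ‼ (suc i) = xs ‼ i

  slice : ℕ → ℕ → List A → List A
  slice i j xs = take (j ∸ i) (drop i xs)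

  Sorted : List A → Set (a ⊔ ℓ)
  Sorted = AllPairs _≼_

  Within : ℕ → ℕ → List A → List A → Set a
  Within i j xs ys =
    length xs ≡ length ys × take i xs ≡ take i ys × drop j xs ≡ drop j ys
    × slice i j xs ↭ slice i j ys

  -- ys sorts the subarray [i..j) of xs (insertion sort / heapsort)
  SortsRange : ℕ → ℕ → List A → List A → Set (a ⊔ ℓ)
  SortsRange i j xs ys = Within i j xs ys × Sorted (slice i j ys)

  PermParts : ℕ → ℕ → ℕ → List A → List A → Set a
  PermParts i r j xs ys =
    length xs ≡ length ys × take i xs ≡ take i ys × drop j xs ≡ drop j ys
    × xs ‼ r ≡ ys ‼ r
    × slice i r xs ↭ slice i r ys × slice (suc r) j xs ↭ slice (suc r) j ys

  elemsAt : List A → List ℕ → List A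
  elemsAt xs ps = mapMaybe (xs ‼_) ps

  MedianOfSample : ℕ → ℕ → List A → A → Set (a ⊔ ℓ)
  MedianOfSample i j xs q =
    Σ (List ℕ) λ ps → 3 ≤ length ps × Unique ps
    × All (λ k → i ≤ k × k < j) ps
    × Σ (List A) λ lo → Σ (List A) λ hi →
        elemsAt xs ps ↭ (lo ++ q ∷ hi)
        × All (λ x → x ≼ q) lo × All (λ x → q ≼ x) hi
        × length lo ∸ length hi ≤ 1 × length hi ∸ length lo ≤ 1

  PivotSel : ℕ → ℕ → List A → List A → A → Set (a ⊔ ℓ)
  PivotSel i j xs xs₁ q =
    MedianOfSample i j xs q × Within i j xs xs₁ × xs₁ ‼ i ≡ just q

  PredEq : ℕ → List A → A → Set (a ⊔ ℓ)
  PredEq i xs q = Σ ℕ λ i' → i ≡ suc i' × Σ A λ d → xs ‼ i' ≡ just d × d ≈ q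

  PartLeft : ℕ → ℕ → A → List A → List A → ℕ → Set (a ⊔ ℓ)
  PartLeft i j q xs ys r =
    Within i j xs ys × i ≤ r × r < j × ys ‼ r ≡ just q
    × (∀ k x → i ≤ k → k < r → ys ‼ k ≡ just x → x ≼ q)
    × (∀ k x → r < k → k < j → ys ‼ k ≡ just x → q ≺ x)

  PartRight : ℕ → ℕ → A → List A → List A → ℕ → Set (a ⊔ ℓ)
  PartRight i j q xs ys r =
    Within i j xs ys × i ≤ r × r < j × ys ‼ r ≡ just q
    × (∀ k x → i ≤ k → k < r → ys ‼ k ≡ just x → x ≺ q)
    × (∀ k x → r < k → k < j → ys ‼ k ≡ just x → q ≼ x)

  Bad : ℕ → ℕ → ℕ → Set
  Bad i r j = ((r ∸ i) ⊓ (j ∸ suc r)) * pd < pn * (j ∸ i)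

  -- no element other than the pivot was moved by the partition
  -- (only positions i, where the pivot was, and r, where it ends, change)
  NoMove : ℕ → ℕ → ℕ → List A → List A → Set a
  NoMove i r j xs ys = ∀ k → i ≤ k → k < j → k ≢ i → k ≢ r → ys ‼ k ≡ xs ‼ k

  -- step (5): counter update and swaps inside both parts on a bad partition
  data BadStep (i r j : ℕ) (xs : List A) : ℕ → ℕ → List A → Set a where
    bad  : ∀ {t ys} → Bad i r j → PermParts i r j xs ys → BadStep i r j xs (suc t) t ys
    good : ∀ {t} → ¬ Bad i r j → BadStep i r j xs t t xs

  -- step (6) when it does not return: xs₁ / xs₂ are the states before /
  -- after partition_right, xs₃ after step (5), result is the state
  -- on which step (7) recurses
  data Step6Cont (i r j : ℕ) (xs₁ xs₂ xs₃ : List A) : List A → Set (a ⊔ ℓ) where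
    wasBad  : Bad i r j → Step6Cont i r j xs₁ xs₂ xs₃ xs₃
    moved   : ¬ NoMove i r j xs₁ xs₂ → Step6Cont i r j xs₁ xs₂ xs₃ xs₃
    aborted : ∀ {xs₄} → ¬ Bad i r j → NoMove i r j xs₁ xs₂ → PermParts i r j xs₃ xs₄
            → Step6Cont i r j xs₁ xs₂ xs₃ xs₄

  data Event : Set a where
    -- a call on [i..j) starts; the array at that moment
    call  : ℕ → ℕ → List A → Event
    -- a pivot q is selected; the array right after its partition step (4)
    pivot : A → List A → Event

  -- Exec t i j xs ys tr : a call on A[i..j) with counter t, started on the
  -- array xs, can terminate with the array ys, emitting the events tr
  data Exec : ℕ → ℕ → ℕ → List A → List A → List Event → Set (a ⊔ ℓ) where
    ins  : ∀ {t i j xs ys} → j ∸ i ≤ c → SortsRange i j xs ys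
         → Exec t i j xs ys (call i j xs ∷ [])
    heap : ∀ {i j xs ys} → c < j ∸ i → SortsRange i j xs ys
         → Exec 0 i j xs ys (call i j xs ∷ [])
    left : ∀ {t t' i j r q xs xs₁ xs₂ xs₃ ys tr}
         → c < j ∸ i → PivotSel i j xs xs₁ q → PredEq i xs₁ q
         → PartLeft i j q xs₁ xs₂ r → BadStep i r j xs₂ (suc t) t' xs₃
         → Exec t' (suc r) j xs₃ ys tr
         → Exec (suc t) i j xs ys (call i j xs ∷ pivot q xs₂ ∷ tr)
    rightDone : ∀ {t i j r q xs xs₁ xs₂ ys}
         → c < j ∸ i → PivotSel i j xs xs₁ q → ¬ PredEq i xs₁ q
         → PartRight i j q xs₁ xs₂ r → ¬ Bad i r j → NoMove i r j xs₁ xs₂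
         → PermParts i r j xs₂ ys → Sorted (slice i r ys) → Sorted (slice (suc r) j ys)
         → Exec (suc t) i j xs ys (call i j xs ∷ pivot q xs₂ ∷ [])
    rightRec : ∀ {t t' i j r q xs xs₁ xs₂ xs₃ xs₄ zs ys tr₁ tr₂}
         → c < j ∸ i → PivotSel i j xs xs₁ q → ¬ PredEq i xs₁ q
         → PartRight i j q xs₁ xs₂ r → BadStep i r j xs₂ (suc t) t' xs₃
         → Step6Cont i r j xs₁ xs₂ xs₃ xs₄
         → Exec t' i r xs₄ zs tr₁ → Exec t' (suc r) j zs ys tr₂
         → Exec (suc t) i j xs ys (call i j xs ∷ pivot q xs₂ ∷ tr₁ ++ tr₂)

  Run : List A → List A → List Event → Set (a ⊔ ℓ)
  Run xs ys tr = Exec ⌊log₂ length xs ⌋ 0 (length xs) xs ys tr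

  EqAt : List A → ℕ → A → Set (a ⊔ ℓ)
  EqAt arr k v = Σ A λ x → arr ‼ k ≡ just x × x ≈ v

  -- all elements comparing equal to v are at their final sorted positions:
  -- arr agrees with every sorted rearrangement of the input xs on which
  -- positions hold elements equal to v
  InFinalPositions : A → List A → List A → Set (a ⊔ ℓ)
  InFinalPositions v xs arr =
    ∀ s → s ↭ xs → Sorted s → ∀ k → (EqAt arr k v → EqAt s k v) × (EqAt s k v → EqAt arr k v)

  PivotEq : A → Event → Set ℓ
  PivotEq v (call _ _ _) = ⊥
  PivotEq v (pivot q _)  = q ≈ v

  AvoidsV : A → Event → Set (a ⊔ ℓ)
  AvoidsV v (call i j arr) = ∀ k → i ≤ k → k < j → ¬ EqAt arr k v
  AvoidsV v (pivot _ _)    = ⊤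

  SecondPivot : A → List Event → List Event → A → List A → List Event → Set (a ⊔ ℓ)
  SecondPivot v tr pre q arr post =
    tr ≡ pre ++ pivot q arr ∷ post × q ≈ v
    × Σ (List Event) λ pre₁ → Σ (List Event) λ pre₂ → Σ A λ q' → Σ (List A) λ arr' →
        pre ≡ pre₁ ++ pivot q' arr' ∷ pre₂ × q' ≈ v
        × All (λ e → ¬ PivotEq v e) pre₁ × All (λ e → ¬ PivotEq v e) pre₂

{-# OPTIONS --safe #-}
-- Every call on A[i..j) starts with A[0..i) sorted and ≼ all of A[i..j), and with
-- everything from position j on above A[i..j). After a first pivot ≈ v, any later call
-- whose subarray still holds elements ≈ v has an element ≈ v in its sorted prefix, so
-- the predecessor of a pivot ≈ v chosen there is ≈ v as well and partition_left runs.
-- That partition packs all remaining elements ≈ v directly after the prefix and leaves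
-- only larger ones to its right: the recursion never meets an element ≈ v again, and
-- counting the elements forced to either side of a position, in the array and in any
-- sorted permutation of the input, shows the elements ≈ v are at their final positions.
module Submission where

open import Defs
open import Level using (_⊔_)
open import Data.Empty using (⊥; ⊥-elim)
open import Data.Nat using (ℕ; zero; suc; _+_; _∸_; _⊓_; _≤_; _<_; z≤n; s≤s)
open import Data.Nat.Properties
open import Data.List using (List; []; _∷_; _++_; length; take; drop; fromMaybe)
open import Data.List.Properties using (take++drop≡id; drop-drop; length-take; length-++; ++-assoc; take-[]; drop-[])
open import Data.List.Membership.Propositional using (_∈_)
open import Data.List.Membership.Propositional.Properties using (∈-++⁻; ∈-∃++)
open import Data.List.Relation.Unary.All as All using (All; []; _∷_)
open import Data.List.Relation.Unary.All.Properties using () renaming (++⁺ to All++⁺)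
open import Data.List.Relation.Unary.Any using (here; there)
open import Data.List.Relation.Unary.AllPairs using (AllPairs; []; _∷_)
open import Data.List.Relation.Binary.Permutation.Propositional
  using (_↭_; ↭-refl; ↭-sym; ↭-trans; ↭-reflexive; module PermutationReasoning)
open import Data.List.Relation.Binary.Permutation.Propositional.Properties
  using (∈-resp-↭; ↭-length; drop-mid; ++⁺ˡ; ++⁺ʳ) renaming (++⁺ to ↭-++⁺)
open import Data.Maybe using (just)
open import Data.Maybe.Properties using (just-injective)
open import Data.Product using (Σ; _×_; _,_; proj₁; proj₂)
open import Data.Sum using (_⊎_; inj₁; inj₂)
open import Relation.Binary.PropositionalEquality
open import Relation.Nullary using (¬_; yes; no)
open import Relation.Nullary.Decidable.Core using (¬¬-excluded-middle)

module _ {a p q} {X : Set a} {P : X → Set p} {Q : X → Set q} (disjoint : ∀ {x} → P x → Q x → ⊥) where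

  ↭-disjoint-length-≤ : ∀ (as bs cs ds : List X) → as ++ bs ↭ cs ++ ds →
                        All P as → All Q ds → length as ≤ length cs
  ↭-disjoint-length-≤ []       bs cs ds σ []         qds = z≤n
  ↭-disjoint-length-≤ (x ∷ as) bs cs ds σ (px ∷ pas) qds with ∈-++⁻ cs (∈-resp-↭ σ (here refl))
  ... | inj₂ x∈ds = ⊥-elim (disjoint px (All.lookup qds x∈ds))
  ... | inj₁ x∈cs with ∈-∃++ x∈cs
  ... | us , ws , refl = subst (suc (length as) ≤_) (sym length-us++x∷ws) (s≤s shorter)
    where
    σ′ : as ++ bs ↭ (us ++ ws) ++ ds
    σ′ = ↭-trans (drop-mid [] us (↭-trans σ (↭-reflexive (++-assoc us (x ∷ ws) ds))))
                 (↭-reflexive (sym (++-assoc us ws ds)))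
    shorter : length as ≤ length (us ++ ws)
    shorter = ↭-disjoint-length-≤ as bs (us ++ ws) ds σ′ pas qds
    length-us++x∷ws : length (us ++ x ∷ ws) ≡ suc (length (us ++ ws))
    length-us++x∷ws = trans (length-++ us) (trans (+-suc (length us) (length ws)) (cong suc (sym (length-++ us))))

  ↭-take-drop-disjoint : ∀ {l₁ l₂ : List X} k → l₁ ↭ l₂ → k < length l₁ →
                         All P (take (suc k) l₁) → All Q (drop k l₂) → ⊥
  ↭-take-drop-disjoint {l₁} {l₂} k σ k<len pre suf = <-irrefl refl (begin-strict
      k                             <⟨ n<1+n k ⟩
      suc k                         ≡⟨ sym (trans (length-take (suc k) l₁) (m≤n⇒m⊓n≡m k<len)) ⟩
      length (take (suc k) l₁)      ≤⟨ ↭-disjoint-length-≤ (take (suc k) l₁) (drop (suc k) l₁) (take k l₂) (drop k l₂) σ′ pre suf ⟩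
      length (take k l₂)            ≡⟨ length-take k l₂ ⟩
      k ⊓ length l₂        ≤⟨ m⊓n≤m k _ ⟩
      k                             ∎)
    where
    open ≤-Reasoning
    σ′ : take (suc k) l₁ ++ drop (suc k) l₁ ↭ take k l₂ ++ drop k l₂
    σ′ = ↭-trans (↭-reflexive (take++drop≡id (suc k) l₁)) (↭-trans σ (↭-reflexive (sym (take++drop≡id k l₂))))

take-+ : ∀ {a} {X : Set a} m n (l : List X) → take (m + n) l ≡ take m l ++ take n (drop m l)
take-+ zero    n l       = refl
take-+ (suc m) n []      = sym (take-[] n)
take-+ (suc m) n (x ∷ l) = cong (x ∷_) (take-+ m n l)

module Pdq {a ℓ} (S : Setting a ℓ) where
  open Setting S
  open Semantics S
  open IsStrictWeakOrder isSWO renaming (trans to ≺-trans; irrefl to ≺-irrefl)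

  ‼⇒< : ∀ (l : List A) k {x} → l ‼ k ≡ just x → k < length l
  ‼⇒< (y ∷ l) zero    _ = s≤s z≤n
  ‼⇒< (y ∷ l) (suc k) e = s≤s (‼⇒< l k e)

  <⇒‼ : ∀ (l : List A) k → k < length l → Σ A λ x → l ‼ k ≡ just x
  <⇒‼ (y ∷ l) zero    _       = y , refl
  <⇒‼ (y ∷ l) (suc k) (s≤s p) = <⇒‼ l k p

  ‼-unique : ∀ (l : List A) k {x y} → l ‼ k ≡ just x → l ‼ k ≡ just y → x ≡ y
  ‼-unique l k e e′ = just-injective (trans (sym e) e′)

  ‼-drop : ∀ (l : List A) i k → drop i l ‼ k ≡ l ‼ (i + k)
  ‼-drop l       zero    k = refl
  ‼-drop []      (suc i) k = refl
  ‼-drop (y ∷ l) (suc i) k = ‼-drop l i k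

  ‼-take : ∀ (l : List A) n k → k < n → take n l ‼ k ≡ l ‼ k
  ‼-take []      (suc n) k       _       = refl
  ‼-take (y ∷ l) (suc n) zero    _       = refl
  ‼-take (y ∷ l) (suc n) (suc k) (s≤s p) = ‼-take l n k p

  ‼-slice : ∀ (l : List A) {i j k} → i ≤ k → k < j → slice i j l ‼ (k ∸ i) ≡ l ‼ k
  ‼-slice l {i} {j} {k} i≤k k<j = begin
    take (j ∸ i) (drop i l) ‼ (k ∸ i) ≡⟨ ‼-take (drop i l) (j ∸ i) (k ∸ i) (∸-monoˡ-< k<j i≤k) ⟩
    drop i l ‼ (k ∸ i)                ≡⟨ ‼-drop l i (k ∸ i) ⟩
    l ‼ (i + (k ∸ i))                 ≡⟨ cong (l ‼_) (m+[n∸m]≡n i≤k) ⟩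
    l ‼ k                             ∎
    where open ≡-Reasoning

  take≡⇒‼≡ : ∀ {xs ys : List A} i {k} → take i xs ≡ take i ys → k < i → xs ‼ k ≡ ys ‼ k
  take≡⇒‼≡ {xs} {ys} i {k} eq k<i =
    trans (sym (‼-take xs i k k<i)) (trans (cong (_‼ k) eq) (‼-take ys i k k<i))

  drop≡⇒‼≡ : ∀ {xs ys : List A} j {k} → drop j xs ≡ drop j ys → j ≤ k → xs ‼ k ≡ ys ‼ k
  drop≡⇒‼≡ {xs} {ys} j {k} eq j≤k = begin
    xs ‼ k              ≡⟨ cong (xs ‼_) (sym (m+[n∸m]≡n j≤k)) ⟩
    xs ‼ (j + (k ∸ j))  ≡⟨ sym (‼-drop xs j (k ∸ j)) ⟩
    drop j xs ‼ (k ∸ j) ≡⟨ cong (_‼ (k ∸ j)) eq ⟩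
    drop j ys ‼ (k ∸ j) ≡⟨ ‼-drop ys j (k ∸ j) ⟩
    ys ‼ (j + (k ∸ j))  ≡⟨ cong (ys ‼_) (m+[n∸m]≡n j≤k) ⟩
    ys ‼ k              ∎
    where open ≡-Reasoning

  ∈⇒‼ : ∀ {x} (l : List A) → x ∈ l → Σ ℕ λ k → l ‼ k ≡ just x
  ∈⇒‼ (y ∷ l) (here refl) = zero , refl
  ∈⇒‼ (y ∷ l) (there x∈l) with k , e ← ∈⇒‼ l x∈l = suc k , e

  ‼⇒∈ : ∀ {x} (l : List A) k → l ‼ k ≡ just x → x ∈ l
  ‼⇒∈ (y ∷ l) zero    refl = here refl
  ‼⇒∈ (y ∷ l) (suc k) e    = there (‼⇒∈ l k e)

  OccursIn : ℕ → ℕ → List A → A → Set a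
  OccursIn i j l x = Σ ℕ λ k → i ≤ k × k < j × l ‼ k ≡ just x

  OccursIn-widen : ∀ {i j i′ j′ x} {l : List A} → i ≤ i′ → j′ ≤ j → OccursIn i′ j′ l x → OccursIn i j l x
  OccursIn-widen i≤i′ j′≤j (k , i′≤k , k<j′ , e) = k , ≤-trans i≤i′ i′≤k , <-≤-trans k<j′ j′≤j , e

  ∈-slice⁺ : ∀ (l : List A) {i j k x} → i ≤ k → k < j → l ‼ k ≡ just x → x ∈ slice i j l
  ∈-slice⁺ l {i} {j} {k} i≤k k<j e = ‼⇒∈ (slice i j l) (k ∸ i) (trans (‼-slice l i≤k k<j) e)

  ∈-slice⁻ : ∀ (l : List A) {i j x} → x ∈ slice i j l → OccursIn i j l x
  ∈-slice⁻ l {i} {j} x∈ with m , e ← ∈⇒‼ (slice i j l) x∈ =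
    i + m , m≤m+n i m , i+m<j , trans (sym (‼-drop l i m)) (trans (sym (‼-take (drop i l) (j ∸ i) m m<j∸i)) e)
    where
    m<j∸i : m < j ∸ i
    m<j∸i = <-≤-trans (‼⇒< (slice i j l) m e) (≤-trans (≤-reflexive (length-take (j ∸ i) (drop i l))) (m⊓n≤m _ _))
    i+m<j : i + m < j
    i+m<j = subst (i + m <_) (m+[n∸m]≡n i≤j) (+-monoʳ-< i m<j∸i)
      where
      i≤j : i ≤ j
      i≤j = <⇒≤ (m∸n≢0⇒n<m (λ eq → n≮0 (subst (m <_) eq m<j∸i)))

  take++slice++drop : ∀ (l : List A) {i j} → i ≤ j → take i l ++ slice i j l ++ drop j l ≡ l
  take++slice++drop l {i} {j} i≤j = begin
    take i l ++ take (j ∸ i) (drop i l) ++ drop j l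
      ≡⟨ cong (λ n → take i l ++ take (j ∸ i) (drop i l) ++ drop n l) (sym (m+[n∸m]≡n i≤j)) ⟩
    take i l ++ take (j ∸ i) (drop i l) ++ drop (i + (j ∸ i)) l
      ≡⟨ cong (λ z → take i l ++ take (j ∸ i) (drop i l) ++ z) (sym (drop-drop i (j ∸ i) l)) ⟩
    take i l ++ take (j ∸ i) (drop i l) ++ drop (j ∸ i) (drop i l)
      ≡⟨ cong (take i l ++_) (take++drop≡id (j ∸ i) (drop i l)) ⟩
    take i l ++ drop i l
      ≡⟨ take++drop≡id i l ⟩
    l ∎
    where open ≡-Reasoning

  slice-++ : ∀ (l : List A) {i r j} → i ≤ r → r ≤ j → slice i r l ++ slice r j l ≡ slice i j l
  slice-++ l {i} {r} {j} i≤r r≤j = begin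
    slice i r l ++ take (j ∸ r) (drop r l)
      ≡⟨ cong (λ n → slice i r l ++ take (j ∸ r) (drop n l)) (sym (m+[n∸m]≡n i≤r)) ⟩
    slice i r l ++ take (j ∸ r) (drop (i + (r ∸ i)) l)
      ≡⟨ cong (λ z → slice i r l ++ take (j ∸ r) z) (sym (drop-drop i (r ∸ i) l)) ⟩
    slice i r l ++ take (j ∸ r) (drop (r ∸ i) (drop i l))
      ≡⟨ sym (take-+ (r ∸ i) (j ∸ r) (drop i l)) ⟩
    take ((r ∸ i) + (j ∸ r)) (drop i l)
      ≡⟨ cong (λ n → take n (drop i l)) (trans (sym (+-∸-comm (j ∸ r) i≤r)) (cong (_∸ i) (m+[n∸m]≡n r≤j))) ⟩
    slice i j l ∎
    where open ≡-Reasoning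

  slice-single : ∀ (l : List A) r → slice r (suc r) l ≡ fromMaybe (l ‼ r)
  slice-single l r = trans (cong (λ n → take n (drop r l)) (m+n∸n≡m 1 r)) (take-1-drop l r)
    where
    take-1-drop : ∀ (l : List A) r → take 1 (drop r l) ≡ fromMaybe (l ‼ r)
    take-1-drop []      r       = cong (take 1) (drop-[] r)
    take-1-drop (y ∷ l) zero    = refl
    take-1-drop (y ∷ l) (suc r) = take-1-drop l r

  slice-around : ∀ (l : List A) {i r j} → i ≤ r → r < j →
                 slice i j l ≡ slice i r l ++ fromMaybe (l ‼ r) ++ slice (suc r) j l
  slice-around l {i} {r} {j} i≤r r<j = begin
    slice i j l                                           ≡⟨ sym (slice-++ l i≤r (<⇒≤ r<j)) ⟩
    slice i r l ++ slice r j l                            ≡⟨ cong (slice i r l ++_) (sym (slice-++ l (n≤1+n r) r<j)) ⟩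
    slice i r l ++ slice r (suc r) l ++ slice (suc r) j l ≡⟨ cong (λ z → slice i r l ++ z ++ slice (suc r) j l) (slice-single l r) ⟩
    slice i r l ++ fromMaybe (l ‼ r) ++ slice (suc r) j l ∎
    where open ≡-Reasoning

  PermParts⇒Within : ∀ {i r j} {xs ys : List A} → i ≤ r → r < j → PermParts i r j xs ys → Within i j xs ys
  PermParts⇒Within {i} {r} {j} {xs} {ys} i≤r r<j (len , tk , dr , er , σ₁ , σ₂) = len , tk , dr , σ
    where
    σ : slice i j xs ↭ slice i j ys
    σ = ↭-trans (↭-reflexive (slice-around xs i≤r r<j))
          (↭-trans (↭-++⁺ σ₁ (↭-++⁺ (↭-reflexive (cong fromMaybe er)) σ₂))
            (↭-reflexive (sym (slice-around ys i≤r r<j))))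

  AllBelow : ∀ {p} → (A → Set p) → ℕ → List A → Set (a ⊔ p)
  AllBelow P i l = ∀ k {x} → k < i → l ‼ k ≡ just x → P x

  AllIn : ∀ {p} → (A → Set p) → ℕ → ℕ → List A → Set (a ⊔ p)
  AllIn P i j l = ∀ k {x} → i ≤ k → k < j → l ‼ k ≡ just x → P x

  AllFrom : ∀ {p} → (A → Set p) → ℕ → List A → Set (a ⊔ p)
  AllFrom P j l = ∀ k {x} → j ≤ k → l ‼ k ≡ just x → P x

  AllIn-map : ∀ {p q} {P : A → Set p} {Q : A → Set q} {i j} {l : List A} →
              (∀ {x} → P x → Q x) → AllIn P i j l → AllIn Q i j l
  AllIn-map f all k i≤k k<j e = f (all k i≤k k<j e)

  AllIn-narrow : ∀ {p} {P : A → Set p} {i j i′ j′} {l : List A} → i ≤ i′ → j′ ≤ j → AllIn P i j l → AllIn P i′ j′ l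
  AllIn-narrow i≤i′ j′≤j all k i′≤k k<j′ = all k (≤-trans i≤i′ i′≤k) (<-≤-trans k<j′ j′≤j)

  AllIn-origin : ∀ {p} {P : A → Set p} {i j} {xs ys : List A} →
                 (∀ {x} → OccursIn i j ys x → OccursIn i j xs x) → AllIn P i j xs → AllIn P i j ys
  AllIn-origin origin all k i≤k k<j e with k′ , i≤k′ , k′<j , e′ ← origin (k , i≤k , k<j , e) = all k′ i≤k′ k′<j e′

  AllBelow⇒All-take : ∀ {p} {P : A → Set p} (l : List A) i → AllBelow P i l → All P (take i l)
  AllBelow⇒All-take []      zero    all = []
  AllBelow⇒All-take []      (suc i) all = []
  AllBelow⇒All-take (y ∷ l) zero    all = []
  AllBelow⇒All-take (y ∷ l) (suc i) all = all zero (s≤s z≤n) refl ∷ AllBelow⇒All-take l i (λ k k<i → all (suc k) (s≤s k<i))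

  AllFrom⇒All-drop : ∀ {p} {P : A → Set p} (l : List A) j → AllFrom P j l → All P (drop j l)
  AllFrom⇒All-drop []      zero    all = []
  AllFrom⇒All-drop []      (suc j) all = []
  AllFrom⇒All-drop (y ∷ l) zero    all = all zero z≤n refl ∷ AllFrom⇒All-drop l zero (λ k _ → all (suc k) z≤n)
  AllFrom⇒All-drop (y ∷ l) (suc j) all = AllFrom⇒All-drop l j (λ k j≤k → all (suc k) (s≤s j≤k))

  SortedIn : ℕ → ℕ → List A → Set (a ⊔ ℓ)
  SortedIn i j l = ∀ k k′ {x y} → i ≤ k → k < k′ → k′ < j → l ‼ k ≡ just x → l ‼ k′ ≡ just y → x ≼ y

  SortedIn-from-0 : ∀ {i j} (l : List A) → SortedIn 0 j l → SortedIn i j l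
  SortedIn-from-0 l sorted k k′ _ = sorted k k′ z≤n

  SortedIn⇒≼ : ∀ {i j} (l : List A) → SortedIn i j l →
               ∀ k k′ {x y} → i ≤ k → k ≤ k′ → k′ < j → l ‼ k ≡ just x → l ‼ k′ ≡ just y → x ≼ y
  SortedIn⇒≼ l sorted k k′ i≤k k≤k′ k′<j e e′ with m≤n⇒m<n∨m≡n k≤k′
  ... | inj₁ k<k′ = sorted k k′ i≤k k<k′ k′<j e e′
  ... | inj₂ refl = subst (_ ≼_) (‼-unique l k e e′) ≺-irrefl

  AllPairs-‼ : ∀ {r} {R : A → A → Set r} {l : List A} → AllPairs R l →
               ∀ {k k′ x y} → k < k′ → l ‼ k ≡ just x → l ‼ k′ ≡ just y → R x y
  AllPairs-‼ {l = z ∷ l} (Rz ∷ _)   {zero}  {suc k′} _         refl e′ = All.lookup Rz (‼⇒∈ l k′ e′)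
  AllPairs-‼ {l = z ∷ l} (_  ∷ Rl)  {suc k} {suc k′} (s≤s k<k′) e e′ = AllPairs-‼ Rl k<k′ e e′

  Sorted⇒SortedIn : ∀ (l : List A) {i j} → Sorted (slice i j l) → SortedIn i j l
  Sorted⇒SortedIn l sorted k k′ i≤k k<k′ k′<j e e′ =
    AllPairs-‼ sorted (∸-monoˡ-< k<k′ i≤k)
      (trans (‼-slice l i≤k (<-trans k<k′ k′<j)) e)
      (trans (‼-slice l (≤-trans i≤k (<⇒≤ k<k′)) k′<j) e′)

  ≺-asym : ∀ {x y} → x ≺ y → ¬ y ≺ x
  ≺-asym x≺y y≺x = ≺-irrefl (≺-trans x≺y y≺x)

  ≺-cotrans : ∀ {x y z} → x ≺ y → ¬ x ≺ z → ¬ z ≺ y → ⊥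
  ≺-cotrans {x} {y} {z} x≺y x⊀z z⊀y = ¬¬-excluded-middle λ where
    (yes y≺z) → x⊀z (≺-trans x≺y y≺z)
    (no y⊀z)  → ¬¬-excluded-middle λ where
      (yes z≺x) → z⊀y (≺-trans z≺x x≺y)
      (no z⊀x)  → proj₁ (incomp-trans (x⊀z , z⊀x) (z⊀y , y⊀z)) x≺y

  ≈-refl : ∀ {x} → x ≈ x
  ≈-refl = ≺-irrefl , ≺-irrefl

  ≈-sym : ∀ {x y} → x ≈ y → y ≈ x
  ≈-sym (x⊀y , y⊀x) = y⊀x , x⊀y

  ≈-trans : ∀ {x y z} → x ≈ y → y ≈ z → x ≈ z
  ≈-trans = incomp-trans

  ≼-trans : ∀ {x y z} → x ≼ y → y ≼ z → x ≼ z
  ≼-trans x≼y y≼z z≺x = ≺-cotrans z≺x y≼z x≼y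

  ≼-respʳ-≈ : ∀ {x y z} → x ≼ y → y ≈ z → x ≼ z
  ≼-respʳ-≈ x≼y (_ , z⊀y) = ≼-trans x≼y z⊀y

  ≼-respˡ-≈ : ∀ {x y z} → x ≼ y → x ≈ z → z ≼ y
  ≼-respˡ-≈ x≼y (x⊀z , _) = ≼-trans x⊀z x≼y

  ≈-SortedIn : ∀ {i j q} {l : List A} → AllIn (_≈ q) i j l → SortedIn i j l
  ≈-SortedIn all k k′ i≤k k<k′ k′<j e e′ =
    proj₂ (≈-trans (all k i≤k (<-trans k<k′ k′<j) e) (≈-sym (all k′ (≤-trans i≤k (<⇒≤ k<k′)) k′<j e′)))

  Sorted⇒AllBelow : ∀ {s : List A} {k y} → Sorted s → s ‼ k ≡ just y → AllBelow (_≼ y) (suc k) s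
  Sorted⇒AllBelow {s} {k} sorted e k′ (s≤s k′≤k) e′ with m≤n⇒m<n∨m≡n k′≤k
  ... | inj₁ k′<k = AllPairs-‼ sorted k′<k e′ e
  ... | inj₂ refl = subst (_≼ _) (‼-unique s k e e′) ≺-irrefl

  Sorted⇒AllFrom : ∀ {s : List A} {k y} → Sorted s → s ‼ k ≡ just y → AllFrom (y ≼_) k s
  Sorted⇒AllFrom {s} {k} sorted e k′ k≤k′ e′ with m≤n⇒m<n∨m≡n k≤k′
  ... | inj₁ k<k′ = AllPairs-‼ sorted k<k′ e e′
  ... | inj₂ refl = subst (_ ≼_) (‼-unique s k e e′) ≺-irrefl

  EqAt-resp-≈ : ∀ {l : List A} {k w v} → w ≈ v → EqAt l k w → EqAt l k v
  EqAt-resp-≈ w≈v (x , e , x≈w) = x , e , ≈-trans x≈w w≈v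

  slice-↭-OccursIn : ∀ {i j x} {xs ys : List A} → slice i j xs ↭ slice i j ys → OccursIn i j ys x → OccursIn i j xs x
  slice-↭-OccursIn {xs = xs} {ys} σ (k , i≤k , k<j , e) = ∈-slice⁻ xs (∈-resp-↭ (↭-sym σ) (∈-slice⁺ ys i≤k k<j e))

  slice-↭-AllIn : ∀ {p} {P : A → Set p} {i j} {xs ys : List A} → slice i j xs ↭ slice i j ys → AllIn P i j xs → AllIn P i j ys
  slice-↭-AllIn {xs = xs} {ys} σ = AllIn-origin {xs = xs} {ys} (slice-↭-OccursIn σ)

  record Shuffle (i j : ℕ) (xs ys : List A) : Set a where
    field
      fixes-below : ∀ k → k < i → ys ‼ k ≡ xs ‼ k
      fixes-from  : ∀ k → j ≤ k → ys ‼ k ≡ xs ‼ k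
      origin      : ∀ {x} → OccursIn i j ys x → OccursIn i j xs x
      perm        : ys ↭ xs
  open Shuffle

  Shuffle-trans : ∀ {i j} {xs ys zs : List A} → Shuffle i j xs ys → Shuffle i j ys zs → Shuffle i j xs zs
  Shuffle-trans σ τ = record
    { fixes-below = λ k k<i → trans (fixes-below τ k k<i) (fixes-below σ k k<i)
    ; fixes-from  = λ k j≤k → trans (fixes-from τ k j≤k) (fixes-from σ k j≤k)
    ; origin      = λ occ → origin σ (origin τ occ)
    ; perm        = ↭-trans (perm τ) (perm σ) }

  Shuffle-widen : ∀ {i j i′ j′} {xs ys : List A} → i ≤ i′ → j′ ≤ j → Shuffle i′ j′ xs ys → Shuffle i j xs ys
  Shuffle-widen {i} {j} {i′} {j′} {xs} {ys} i≤i′ j′≤j σ = record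
    { fixes-below = λ k k<i → fixes-below σ k (<-≤-trans k<i i≤i′)
    ; fixes-from  = λ k j≤k → fixes-from σ k (≤-trans j′≤j j≤k)
    ; origin      = widened
    ; perm        = perm σ }
    where
    widened : ∀ {x} → OccursIn i j ys x → OccursIn i j xs x
    widened (k , i≤k , k<j , e) with k <? i′ | j′ ≤? k
    ... | yes k<i′ | _        = k , i≤k , k<j , trans (sym (fixes-below σ k k<i′)) e
    ... | no _     | yes j′≤k = k , i≤k , k<j , trans (sym (fixes-from σ k j′≤k)) e
    ... | no k≮i′  | no j′≰k  = OccursIn-widen {l = xs} i≤i′ j′≤j (origin σ (k , ≮⇒≥ k≮i′ , ≰⇒> j′≰k , e))

  Within⇒Shuffle : ∀ {i j} {xs ys : List A} → i ≤ j → Within i j xs ys → Shuffle i j xs ys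
  Within⇒Shuffle {i} {j} {xs} {ys} i≤j (_ , tk , dr , σ) = record
    { fixes-below = λ k k<i → sym (take≡⇒‼≡ i tk k<i)
    ; fixes-from  = λ k j≤k → sym (drop≡⇒‼≡ j dr j≤k)
    ; origin      = slice-↭-OccursIn σ
    ; perm        = begin
        ys                                       ≡⟨ sym (take++slice++drop ys i≤j) ⟩
        take i ys ++ slice i j ys ++ drop j ys   ≡⟨ cong₂ (λ u w → u ++ slice i j ys ++ w) (sym tk) (sym dr) ⟩
        take i xs ++ slice i j ys ++ drop j xs   ↭⟨ ++⁺ˡ (take i xs) (++⁺ʳ (drop j xs) (↭-sym σ)) ⟩
        take i xs ++ slice i j xs ++ drop j xs   ≡⟨ take++slice++drop xs i≤j ⟩
        xs                                       ∎ }
    where open PermutationReasoning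

  AllIn-Shuffle : ∀ {p} {P : A → Set p} {i j} {xs ys : List A} → Shuffle i j xs ys → AllIn P i j xs → AllIn P i j ys
  AllIn-Shuffle {xs = xs} {ys} σ = AllIn-origin {xs = xs} {ys} (origin σ)

  PermParts-refl : ∀ {i r j} {xs : List A} → PermParts i r j xs xs
  PermParts-refl = refl , refl , refl , refl , ↭-refl , ↭-refl

  PermParts⇒Shuffle : ∀ {i r j} {xs ys : List A} → i ≤ r → r < j → PermParts i r j xs ys → Shuffle i j xs ys
  PermParts⇒Shuffle i≤r r<j π = Within⇒Shuffle (≤-trans i≤r (<⇒≤ r<j)) (PermParts⇒Within i≤r r<j π)

  BadStep⇒PermParts : ∀ {i r j t t′} {xs ys : List A} → BadStep i r j xs t t′ ys → PermParts i r j xs ys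
  BadStep⇒PermParts (bad _ π) = π
  BadStep⇒PermParts {j = j} (good _) = PermParts-refl {j = j}

  Step6Cont⇒PermParts : ∀ {i r j} {xs₁ xs₂ xs₃ xs₄ : List A} → Step6Cont i r j xs₁ xs₂ xs₃ xs₄ → PermParts i r j xs₃ xs₄
  Step6Cont⇒PermParts {j = j} (wasBad _) = PermParts-refl {j = j}
  Step6Cont⇒PermParts {j = j} (moved _)  = PermParts-refl {j = j}
  Step6Cont⇒PermParts (aborted _ _ π) = π

  c<j∸i⇒i<j : ∀ {i j} → c < j ∸ i → i < j
  c<j∸i⇒i<j c<j∸i = m∸n≢0⇒n<m (λ eq → n≮0 (subst (c <_) eq c<j∸i))

  PivotSel⇒Shuffle : ∀ {i j q} {xs xs₁ : List A} → i ≤ j → PivotSel i j xs xs₁ q → Shuffle i j xs xs₁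
  PivotSel⇒Shuffle i≤j (_ , w , _) = Within⇒Shuffle i≤j w

  PivotSel⇒OccursIn : ∀ {i j q} {xs xs₁ : List A} → c < j ∸ i → PivotSel i j xs xs₁ q → OccursIn i j xs q
  PivotSel⇒OccursIn c<j∸i sel@(_ , _ , e) =
    origin (PivotSel⇒Shuffle (<⇒≤ i<j) sel) (_ , ≤-refl , i<j , e)
    where i<j = c<j∸i⇒i<j c<j∸i

  Shuffle-before-left-call :
    ∀ {i j r q t t′} {xs xs₁ xs₂ xs₃ : List A} →
    PivotSel i j xs xs₁ q → PartLeft i j q xs₁ xs₂ r → BadStep i r j xs₂ t t′ xs₃ → Shuffle i j xs xs₃
  Shuffle-before-left-call sel (w , i≤r , r<j , _) bs =
    Shuffle-trans (PivotSel⇒Shuffle i≤j sel)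
      (Shuffle-trans (Within⇒Shuffle i≤j w) (PermParts⇒Shuffle i≤r r<j (BadStep⇒PermParts bs)))
    where i≤j = ≤-trans i≤r (<⇒≤ r<j)

  Shuffle-before-right-calls :
    ∀ {i j r q t t′} {xs xs₁ xs₂ xs₃ xs₄ : List A} →
    PivotSel i j xs xs₁ q → PartRight i j q xs₁ xs₂ r → BadStep i r j xs₂ t t′ xs₃ →
    Step6Cont i r j xs₁ xs₂ xs₃ xs₄ → Shuffle i j xs xs₄
  Shuffle-before-right-calls sel (w , i≤r , r<j , _) bs s6 =
    Shuffle-trans (PivotSel⇒Shuffle i≤j sel)
      (Shuffle-trans (Within⇒Shuffle i≤j w)
        (Shuffle-trans (PermParts⇒Shuffle i≤r r<j (BadStep⇒PermParts bs))
          (PermParts⇒Shuffle i≤r r<j (Step6Cont⇒PermParts s6))))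
    where i≤j = ≤-trans i≤r (<⇒≤ r<j)

  Exec-Shuffle : ∀ {t i j tr} {xs ys : List A} → Exec t i j xs ys tr → i ≤ j → Shuffle i j xs ys
  Exec-Shuffle (ins _ (w , _))  i≤j = Within⇒Shuffle i≤j w
  Exec-Shuffle (heap _ (w , _)) i≤j = Within⇒Shuffle i≤j w
  Exec-Shuffle (left _ sel _ part@(_ , i≤r , r<j , _) bs ex) _ =
    Shuffle-trans (Shuffle-before-left-call sel part bs)
      (Shuffle-widen (≤-trans i≤r (n≤1+n _)) ≤-refl (Exec-Shuffle ex r<j))
  Exec-Shuffle (rightDone _ sel _ part@(w , i≤r , r<j , _) _ _ π _ _) i≤j =
    Shuffle-trans (PivotSel⇒Shuffle i≤j sel)
      (Shuffle-trans (Within⇒Shuffle i≤j w) (PermParts⇒Shuffle i≤r r<j π))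
  Exec-Shuffle (rightRec _ sel _ part@(_ , i≤r , r<j , _) bs s6 ex₁ ex₂) _ =
    Shuffle-trans (Shuffle-before-right-calls sel part bs s6)
      (Shuffle-trans (Shuffle-widen ≤-refl (<⇒≤ r<j) (Exec-Shuffle ex₁ i≤r))
        (Shuffle-widen (≤-trans i≤r (n≤1+n _)) ≤-refl (Exec-Shuffle ex₂ r<j)))

  EventWithin : ℕ → ℕ → List A → Event → Set a
  EventWithin i j xs (call i′ j′ arr) = AllIn (OccursIn i j xs) i′ j′ arr
  EventWithin i j xs (pivot q _)      = OccursIn i j xs q

  EventWithin-call : ∀ {i j} (xs : List A) → EventWithin i j xs (call i j xs)
  EventWithin-call xs k i≤k k<j e = k , i≤k , k<j , e

  EventWithin-Shuffle : ∀ {i j i′ j′} {xs xs′ : List A} → Shuffle i j xs xs′ → i ≤ i′ → j′ ≤ j →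
                        ∀ {e} → EventWithin i′ j′ xs′ e → EventWithin i j xs e
  EventWithin-Shuffle {xs′ = xs′} σ i≤i′ j′≤j {call _ _ _} within k i″≤k k<j″ e =
    origin σ (OccursIn-widen {l = xs′} i≤i′ j′≤j (within k i″≤k k<j″ e))
  EventWithin-Shuffle {xs′ = xs′} σ i≤i′ j′≤j {pivot _ _} occ = origin σ (OccursIn-widen {l = xs′} i≤i′ j′≤j occ)

  Exec-EventsWithin : ∀ {t i j tr} {xs ys : List A} → Exec t i j xs ys tr → i ≤ j → All (EventWithin i j xs) tr
  Exec-EventsWithin {xs = xs} (ins _ _)  _ = EventWithin-call xs ∷ []
  Exec-EventsWithin {xs = xs} (heap _ _) _ = EventWithin-call xs ∷ []
  Exec-EventsWithin {xs = xs} (left c< sel _ part@(_ , i≤r , r<j , _) bs ex) _ =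
    EventWithin-call xs ∷ PivotSel⇒OccursIn c< sel
    ∷ All.map (EventWithin-Shuffle (Shuffle-before-left-call sel part bs) (≤-trans i≤r (n≤1+n _)) ≤-refl)
              (Exec-EventsWithin ex r<j)
  Exec-EventsWithin {xs = xs} (rightDone c< sel _ _ _ _ _ _ _) _ =
    EventWithin-call xs ∷ PivotSel⇒OccursIn c< sel ∷ []
  Exec-EventsWithin {xs = xs} (rightRec c< sel _ part@(_ , i≤r , r<j , _) bs s6 ex₁ ex₂) _ =
    EventWithin-call xs ∷ PivotSel⇒OccursIn c< sel
    ∷ All++⁺ (All.map (EventWithin-Shuffle σ ≤-refl (<⇒≤ r<j)) (Exec-EventsWithin ex₁ i≤r))
             (All.map (EventWithin-Shuffle (Shuffle-trans σ (Shuffle-widen ≤-refl (<⇒≤ r<j) (Exec-Shuffle ex₁ i≤r)))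
                                           (≤-trans i≤r (n≤1+n _)) ≤-refl)
                      (Exec-EventsWithin ex₂ r<j))
    where σ = Shuffle-before-right-calls sel part bs s6

  -- the shape of the array right after partition_left around w
  record Settled (w : A) (i r : ℕ) (arr : List A) : Set (a ⊔ ℓ) where
    field
      sorted-below : SortedIn 0 i arr
      below≼       : AllBelow (_≼ w) i arr
      block≈       : AllIn (_≈ w) i (suc r) arr
      above≻       : AllFrom (λ x → ¬ ¬ w ≺ x) (suc r) arr

  module _ {w i r} {arr : List A} (St : Settled w i r arr) where
    open Settled St

    locate : ∀ k → k < i ⊎ (i ≤ k × k ≤ r) ⊎ r < k
    locate k with k <? i | k ≤? r
    ... | yes k<i | _       = inj₁ k<i
    ... | no k≮i  | yes k≤r = inj₂ (inj₁ (≮⇒≥ k≮i , k≤r))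
    ... | no _    | no k≰r  = inj₂ (inj₂ (≰⇒> k≰r))

    ≈-at⇒≤ : ∀ k {x} → arr ‼ k ≡ just x → x ≈ w → k ≤ r
    ≈-at⇒≤ k e x≈w with k ≤? r
    ... | yes k≤r = k≤r
    ... | no k≰r  = ⊥-elim (above≻ k (≰⇒> k≰r) e (proj₂ x≈w))

    ≺-at⇒< : ∀ k {x} → arr ‼ k ≡ just x → x ≺ w → k < i
    ≺-at⇒< k e x≺w with locate k
    ... | inj₁ k<i                = k<i
    ... | inj₂ (inj₁ (i≤k , k≤r)) = ⊥-elim (proj₁ (block≈ k i≤k (s≤s k≤r) e) x≺w)
    ... | inj₂ (inj₂ r<k)         = ⊥-elim (above≻ k r<k e (≺-asym x≺w))

    ≻-at⇒> : ∀ k {x} → arr ‼ k ≡ just x → w ≺ x → r < k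
    ≻-at⇒> k e w≺x with locate k
    ... | inj₁ k<i                = ⊥-elim (below≼ k k<i e w≺x)
    ... | inj₂ (inj₁ (i≤k , k≤r)) = ⊥-elim (proj₂ (block≈ k i≤k (s≤s k≤r) e) w≺x)
    ... | inj₂ (inj₂ r<k)         = r<k

    ≈-at⇒AllFrom : ∀ k {x} → arr ‼ k ≡ just x → x ≈ w → AllFrom (w ≼_) k arr
    ≈-at⇒AllFrom k {x} e x≈w k′ k≤k′ e′ with locate k′
    ... | inj₁ k′<i                 = ≼-respˡ-≈ (SortedIn⇒≼ arr sorted-below k k′ z≤n k≤k′ k′<i e e′) x≈w
    ... | inj₂ (inj₁ (i≤k′ , k′≤r)) = proj₁ (block≈ k′ i≤k′ (s≤s k′≤r) e′)
    ... | inj₂ (inj₂ r<k′)          = λ z≺w → above≻ k′ r<k′ e′ (λ w≺z → ≺-asym w≺z z≺w)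

    ≈-at⇒AllBelow : ∀ k {x} → arr ‼ k ≡ just x → x ≈ w → AllBelow (_≼ w) (suc k) arr
    ≈-at⇒AllBelow k e x≈w k′ (s≤s k′≤k) e′ with k′ <? i
    ... | yes k′<i = below≼ k′ k′<i e′
    ... | no k′≮i  = proj₂ (block≈ k′ (≮⇒≥ k′≮i) (s≤s (≤-trans k′≤k (≈-at⇒≤ k e x≈w))) e′)

    ≺-at⇒AllBelow : ∀ k {x} → arr ‼ k ≡ just x → x ≺ w → AllBelow (_≼ x) (suc k) arr
    ≺-at⇒AllBelow k e x≺w k′ (s≤s k′≤k) e′ = SortedIn⇒≼ arr sorted-below k′ k z≤n k′≤k (≺-at⇒< k e x≺w) e′ e

    ≻-at⇒AllFrom : ∀ k {x} → arr ‼ k ≡ just x → w ≺ x → AllFrom (λ z → ¬ ¬ w ≺ z) k arr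
    ≻-at⇒AllFrom k e w≺x k′ k≤k′ = above≻ k′ (<-≤-trans (≻-at⇒> k e w≺x) k≤k′)

  -- Each direction is a counting argument: if position k disagreed, too many
  -- elements would have to fit on one side of k in one of the two arrays.
  Settled⇒InFinalPositions : ∀ {w i r} {xs arr : List A} → Settled w i r arr → arr ↭ xs → InFinalPositions w xs arr
  Settled⇒InFinalPositions {w} {xs = xs} {arr} St arr↭xs s s↭xs sorted k = arr⇒s , s⇒arr
    where
    s↭arr : s ↭ arr
    s↭arr = ↭-trans s↭xs (↭-sym arr↭xs)
    arr⇒s : EqAt arr k w → EqAt s k w
    arr⇒s (x , e , x≈w) with y , e′ ← <⇒‼ s k (subst (k <_) (sym (↭-length s↭arr)) (‼⇒< arr k e)) = y , e′ , y⊀w , w⊀y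
      where
      y⊀w : ¬ y ≺ w
      y⊀w y≺w = ↭-take-drop-disjoint (λ z≼y w≼z → ≺-cotrans y≺w z≼y w≼z) k s↭arr (‼⇒< s k e′)
        (AllBelow⇒All-take s (suc k) (Sorted⇒AllBelow sorted e′)) (AllFrom⇒All-drop arr k (≈-at⇒AllFrom St k e x≈w))
      w⊀y : ¬ w ≺ y
      w⊀y w≺y = ↭-take-drop-disjoint (λ z≼w y≼z → ≺-cotrans w≺y z≼w y≼z) k (↭-sym s↭arr) (‼⇒< arr k e)
        (AllBelow⇒All-take arr (suc k) (≈-at⇒AllBelow St k e x≈w)) (AllFrom⇒All-drop s k (Sorted⇒AllFrom sorted e′))
    s⇒arr : EqAt s k w → EqAt arr k w
    s⇒arr (y , e′ , y≈w) with x , e ← <⇒‼ arr k (subst (k <_) (↭-length s↭arr) (‼⇒< s k e′)) = x , e , x⊀w , w⊀x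
      where
      x⊀w : ¬ x ≺ w
      x⊀w x≺w = ↭-take-drop-disjoint (λ z≼x w≼z → ≺-cotrans x≺w z≼x w≼z) k (↭-sym s↭arr) (‼⇒< arr k e)
        (AllBelow⇒All-take arr (suc k) (≺-at⇒AllBelow St k e x≺w))
        (AllFrom⇒All-drop s k (λ k′ k≤k′ e″ → ≼-respˡ-≈ (Sorted⇒AllFrom sorted e′ k′ k≤k′ e″) y≈w))
      w⊀x : ¬ w ≺ x
      w⊀x w≺x = ↭-take-drop-disjoint (λ z≼w w≺z → w≺z z≼w) k s↭arr (‼⇒< s k e′)
        (AllBelow⇒All-take s (suc k) (λ k′ k′≤k e″ → ≼-respʳ-≈ (Sorted⇒AllBelow sorted e′ k′ k′≤k e″) y≈w))
        (AllFrom⇒All-drop arr k (≻-at⇒AllFrom St k e w≺x))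

  InFinalPositions-resp-≈ : ∀ {w v} {xs arr : List A} → w ≈ v → InFinalPositions w xs arr → InFinalPositions v xs arr
  InFinalPositions-resp-≈ {arr = arr} w≈v final s s↭xs sorted k =
      (λ at → EqAt-resp-≈ {l = s} w≈v (proj₁ (final s s↭xs sorted k) (EqAt-resp-≈ {l = arr} (≈-sym w≈v) at)))
    , (λ at → EqAt-resp-≈ {l = arr} w≈v (proj₂ (final s s↭xs sorted k) (EqAt-resp-≈ {l = s} (≈-sym w≈v) at)))

  module _ (v : A) where

    data IsFirstPivot : List Event → A → List A → List Event → Set (a ⊔ ℓ) where
      here  : ∀ {q arr post} → q ≈ v → IsFirstPivot (pivot q arr ∷ post) q arr post
      there : ∀ {e tr q arr post} → ¬ PivotEq v e → IsFirstPivot tr q arr post → IsFirstPivot (e ∷ tr) q arr post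

    data IsSecondPivot : List Event → A → List A → List Event → Set (a ⊔ ℓ) where
      first : ∀ {q′ arr′ rest q arr post} → q′ ≈ v → IsFirstPivot rest q arr post →
              IsSecondPivot (pivot q′ arr′ ∷ rest) q arr post
      skip  : ∀ {e tr q arr post} → ¬ PivotEq v e → IsSecondPivot tr q arr post → IsSecondPivot (e ∷ tr) q arr post

    NoPivotEq : List Event → Set (a ⊔ ℓ)
    NoPivotEq = All (λ e → ¬ PivotEq v e)

    IsFirstPivot-after : ∀ {pre q arr post} → NoPivotEq pre → q ≈ v → IsFirstPivot (pre ++ pivot q arr ∷ post) q arr post
    IsFirstPivot-after []          q≈v = here q≈v
    IsFirstPivot-after (¬e ∷ none) q≈v = there ¬e (IsFirstPivot-after none q≈v)

    IsSecondPivot-after : ∀ {pre₁ pre₂ q′ arr′ q arr post} → NoPivotEq pre₁ → q′ ≈ v → NoPivotEq pre₂ → q ≈ v →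
                          IsSecondPivot ((pre₁ ++ pivot q′ arr′ ∷ pre₂) ++ pivot q arr ∷ post) q arr post
    IsSecondPivot-after []           q′≈v none₂ q≈v = first q′≈v (IsFirstPivot-after none₂ q≈v)
    IsSecondPivot-after (¬e ∷ none₁) q′≈v none₂ q≈v = skip ¬e (IsSecondPivot-after none₁ q′≈v none₂ q≈v)

    PivotEqIn : List Event → Set (a ⊔ ℓ)
    PivotEqIn tr = Σ A λ q → Σ (List A) λ arr → pivot q arr ∈ tr × q ≈ v

    IsFirstPivot⇒PivotEqIn : ∀ {tr q arr post} → IsFirstPivot tr q arr post → PivotEqIn tr
    IsFirstPivot⇒PivotEqIn (here q≈v) = _ , _ , here refl , q≈v
    IsFirstPivot⇒PivotEqIn (there _ f) with q , arr , ∈tr , q≈v ← IsFirstPivot⇒PivotEqIn f = q , arr , there ∈tr , q≈v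

    IsSecondPivot⇒PivotEqIn : ∀ {tr q arr post} → IsSecondPivot tr q arr post → PivotEqIn tr
    IsSecondPivot⇒PivotEqIn (first q′≈v _) = _ , _ , here refl , q′≈v
    IsSecondPivot⇒PivotEqIn (skip _ t) with q , arr , ∈tr , q≈v ← IsSecondPivot⇒PivotEqIn t = q , arr , there ∈tr , q≈v

    NoPivotEq-¬PivotEqIn : ∀ {tr} → NoPivotEq tr → ¬ PivotEqIn tr
    NoPivotEq-¬PivotEqIn none (_ , _ , ∈tr , q≈v) = All.lookup none ∈tr q≈v

    IsFirstPivot-++-elim :
      ∀ tr₁ {tr₂ q arr post} {b} {B : List Event → Set b} → IsFirstPivot (tr₁ ++ tr₂) q arr post →
      (∀ {post₁} → IsFirstPivot tr₁ q arr post₁ → B (post₁ ++ tr₂)) →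
      (NoPivotEq tr₁ → IsFirstPivot tr₂ q arr post → B post) → B post
    IsFirstPivot-++-elim []        f          in₁ in₂ = in₂ [] f
    IsFirstPivot-++-elim (_ ∷ tr₁) (here q≈v) in₁ in₂ = in₁ (here q≈v)
    IsFirstPivot-++-elim (_ ∷ tr₁) {B = B} (there ¬e f) in₁ in₂ =
      IsFirstPivot-++-elim tr₁ {B = B} f (λ f₁ → in₁ (there ¬e f₁)) (λ none f₂ → in₂ (¬e ∷ none) f₂)

    IsSecondPivot-++-elim :
      ∀ tr₁ {tr₂ q arr post} {b} {B : List Event → Set b} → IsSecondPivot (tr₁ ++ tr₂) q arr post →
      (∀ {post₁} → IsSecondPivot tr₁ q arr post₁ → B (post₁ ++ tr₂)) →
      (∀ {q′ arr′ rest₁} → IsFirstPivot tr₁ q′ arr′ rest₁ → IsFirstPivot tr₂ q arr post → B post) →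
      (NoPivotEq tr₁ → IsSecondPivot tr₂ q arr post → B post) → B post
    IsSecondPivot-++-elim []        t              in₁ split in₂ = in₂ [] t
    IsSecondPivot-++-elim (_ ∷ tr₁) {B = B} (first q′≈v f) in₁ split in₂ =
      IsFirstPivot-++-elim tr₁ {B = B} f (λ f₁ → in₁ (first q′≈v f₁)) (λ _ f₂ → split (here q′≈v) f₂)
    IsSecondPivot-++-elim (_ ∷ tr₁) {B = B} (skip ¬e t) in₁ split in₂ =
      IsSecondPivot-++-elim tr₁ {B = B} t (λ t₁ → in₁ (skip ¬e t₁)) (λ f₁ f₂ → split (there ¬e f₁) f₂)
        (λ none t₂ → in₂ (¬e ∷ none) t₂)

    Free : ℕ → ℕ → List A → Set (a ⊔ ℓ)
    Free = AllIn (λ x → ¬ x ≈ v)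

    below-≈-Free : ∀ {q i j} {l : List A} → q ≈ v → AllIn (_≺ q) i j l → Free i j l
    below-≈-Free {l = l} q≈v = AllIn-map {l = l} (λ x≺q x≈v → proj₁ (≈-trans x≈v (≈-sym q≈v)) x≺q)

    above-≈-Free : ∀ {q i j} {l : List A} → q ≈ v → AllIn (λ x → ¬ ¬ q ≺ x) i j l → Free i j l
    above-≈-Free {l = l} q≈v = AllIn-map {l = l} (λ q≺x x≈v → q≺x (proj₂ (≈-trans x≈v (≈-sym q≈v))))

    Exec-AvoidsV : ∀ {t i j tr} {xs ys : List A} → Exec t i j xs ys tr → i ≤ j → Free i j xs → All (AvoidsV v) tr
    Exec-AvoidsV {i = i} {j} {xs = xs} ex i≤j free = All.map avoids (Exec-EventsWithin ex i≤j)
      where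
      avoids : ∀ {e} → EventWithin i j xs e → AvoidsV v e
      avoids {call _ _ _} within k i≤k k<j (x , e , x≈v) with k′ , i≤k′ , k′<j , e′ ← within k i≤k k<j e =
        free k′ i≤k′ k′<j e′ x≈v
      avoids {pivot _ _}  _ = _

    Exec-NoPivotEq : ∀ {t i j tr} {xs ys : List A} → Exec t i j xs ys tr → i ≤ j → Free i j xs → NoPivotEq tr
    Exec-NoPivotEq {i = i} {j} {xs = xs} ex i≤j free = All.map no-pivot (Exec-EventsWithin ex i≤j)
      where
      no-pivot : ∀ {e} → EventWithin i j xs e → ¬ PivotEq v e
      no-pivot {call _ _ _} _ ()
      no-pivot {pivot _ _}  (k , i≤k , k<j , e) = free k i≤k k<j e

    SeenBelow : ℕ → List A → Set (a ⊔ ℓ)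
    SeenBelow i l = Σ ℕ λ k → k < i × EqAt l k v

    SeenBelow-Shuffle : ∀ {i j i′} {xs ys : List A} → SeenBelow i xs → Shuffle i j xs ys → i ≤ i′ → SeenBelow i′ ys
    SeenBelow-Shuffle (k , k<i , x , e , x≈v) σ i≤i′ = k , <-≤-trans k<i i≤i′ , x , trans (fixes-below σ k k<i) e , x≈v

  module _ (x₀ : List A) where

    record CallInv (i j : ℕ) (xs : List A) : Set (a ⊔ ℓ) where
      field
        i≤j           : i ≤ j
        perm-x₀       : xs ↭ x₀
        sorted-prefix : SortedIn 0 i xs
        prefix≼range  : AllBelow (λ x → AllIn (x ≼_) i j xs) i xs
        -- ≺ is not decidable, so beyond the range only ¬ ¬ z ≺ y survives
        range≺suffix  : AllFrom (λ y → AllIn (λ z → ¬ ¬ z ≺ y) i j xs) j xs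
    open CallInv

    CallInv-Shuffle : ∀ {i j} {xs ys : List A} → CallInv i j xs → Shuffle i j xs ys → CallInv i j ys
    CallInv-Shuffle {i} {j} {xs} {ys} I σ = record
      { i≤j           = i≤j I
      ; perm-x₀       = ↭-trans (perm σ) (perm-x₀ I)
      ; sorted-prefix = λ k k′ _ k<k′ k′<i e e′ →
          sorted-prefix I k k′ z≤n k<k′ k′<i (below k (<-trans k<k′ k′<i) e) (below k′ k′<i e′)
      ; prefix≼range  = λ k k<i e → AllIn-Shuffle σ (prefix≼range I k k<i (below k k<i e))
      ; range≺suffix  = λ k j≤k e → AllIn-Shuffle σ (range≺suffix I k j≤k (trans (sym (fixes-from σ k j≤k)) e)) }
      where
      below : ∀ k {x} → k < i → ys ‼ k ≡ just x → xs ‼ k ≡ just x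
      below k k<i e = trans (sym (fixes-below σ k k<i)) e

    CallInv-initial : CallInv 0 (length x₀) x₀
    CallInv-initial = record
      { i≤j           = z≤n
      ; perm-x₀       = ↭-refl
      ; sorted-prefix = λ _ _ _ _ ()
      ; prefix≼range  = λ _ ()
      ; range≺suffix  = λ k ∣x₀∣≤k e → ⊥-elim (<-irrefl refl (<-≤-trans (‼⇒< x₀ k e) ∣x₀∣≤k)) }

    SortedIn-join : ∀ {i j} {l : List A} → CallInv i j l → SortedIn i j l → SortedIn 0 j l
    SortedIn-join {i} I sorted k k′ _ k<k′ k′<j e e′ with k′ <? i | k <? i
    ... | yes k′<i | _       = sorted-prefix I k k′ z≤n k<k′ k′<i e e′
    ... | no k′≮i  | yes k<i = prefix≼range I k k<i e k′ (≮⇒≥ k′≮i) k′<j e′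
    ... | no _     | no k≮i  = sorted k k′ (≮⇒≥ k≮i) k<k′ k′<j e e′

    record Partitioned (Lo Hi : A → Set ℓ) (i r j : ℕ) (q : A) (l : List A) : Set (a ⊔ ℓ) where
      field
        inv      : CallInv i j l
        i≤r      : i ≤ r
        r<j      : r < j
        pivot-at : l ‼ r ≡ just q
        lower    : AllIn Lo i r l
        upper    : AllIn Hi (suc r) j l
    open Partitioned

    Partitioned-PermParts : ∀ {Lo Hi i r j q} {l l′ : List A} →
                            Partitioned Lo Hi i r j q l → PermParts i r j l l′ → Partitioned Lo Hi i r j q l′
    Partitioned-PermParts {l = l} {l′} P π@(_ , _ , _ , at-r , σ₁ , σ₂) = record
      { inv      = CallInv-Shuffle (inv P) (PermParts⇒Shuffle (i≤r P) (r<j P) π)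
      ; i≤r      = i≤r P
      ; r<j      = r<j P
      ; pivot-at = trans (sym at-r) (pivot-at P)
      ; lower    = slice-↭-AllIn {xs = l} {l′} σ₁ (lower P)
      ; upper    = slice-↭-AllIn {xs = l} {l′} σ₂ (upper P) }

    Partitioned-Shuffle-lower : ∀ {Lo Hi i r j q} {l l′ : List A} →
                                Partitioned Lo Hi i r j q l → Shuffle i r l l′ → Partitioned Lo Hi i r j q l′
    Partitioned-Shuffle-lower {r = r} P σ = record
      { inv      = CallInv-Shuffle (inv P) (Shuffle-widen ≤-refl (<⇒≤ (r<j P)) σ)
      ; i≤r      = i≤r P
      ; r<j      = r<j P
      ; pivot-at = trans (fixes-from σ r ≤-refl) (pivot-at P)
      ; lower    = AllIn-Shuffle σ (lower P)
      ; upper    = λ k r<k k<j e → upper P k r<k k<j (trans (sym (fixes-from σ k (<⇒≤ r<k))) e) }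

    partition-right : ∀ {i j r q} {xs xs₁ xs₂ : List A} → CallInv i j xs →
                      PivotSel i j xs xs₁ q → PartRight i j q xs₁ xs₂ r → Partitioned (_≺ q) (q ≼_) i r j q xs₂
    partition-right I sel (w , i≤r , r<j , at-r , lo , hi) = record
      { inv      = CallInv-Shuffle I (Shuffle-trans (PivotSel⇒Shuffle (i≤j I) sel) (Within⇒Shuffle (i≤j I) w))
      ; i≤r      = i≤r
      ; r<j      = r<j
      ; pivot-at = at-r
      ; lower    = λ k → lo k _
      ; upper    = λ k → hi k _ }

    -- the predecessor d ≈ q bounds the lower part from below, so x ≼ q forces x ≈ q
    partition-left : ∀ {i j r q} {xs xs₁ xs₂ : List A} → CallInv i j xs →
                     PivotSel i j xs xs₁ q → PredEq i xs₁ q → PartLeft i j q xs₁ xs₂ r →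
                     Partitioned (_≈ q) (q ≺_) i r j q xs₂
    partition-left {xs₂ = xs₂} I sel (i′ , refl , d , at-i′ , d≈q) (w , i≤r , r<j , at-r , lo , hi) = record
      { inv      = I₂
      ; i≤r      = i≤r
      ; r<j      = r<j
      ; pivot-at = at-r
      ; lower    = λ k i≤k k<r e →
          (λ x≺q → ≺-cotrans x≺q (prefix≼range I₂ i′ ≤-refl d-at k i≤k (<-trans k<r r<j) e) (proj₁ d≈q))
          , lo k _ i≤k k<r e
      ; upper    = λ k → hi k _ }
      where
      σ₂ = Within⇒Shuffle (i≤j I) w
      I₂ = CallInv-Shuffle I (Shuffle-trans (PivotSel⇒Shuffle (i≤j I) sel) σ₂)
      d-at : xs₂ ‼ i′ ≡ just d
      d-at = trans (fixes-below σ₂ i′ ≤-refl) at-i′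

    partitioned-before-left-call :
      ∀ {i j r q t t′} {xs xs₁ xs₂ xs₃ : List A} → CallInv i j xs →
      PivotSel i j xs xs₁ q → PredEq i xs₁ q → PartLeft i j q xs₁ xs₂ r → BadStep i r j xs₂ t t′ xs₃ →
      Partitioned (_≈ q) (q ≺_) i r j q xs₃
    partitioned-before-left-call I sel pe part bs =
      Partitioned-PermParts (partition-left I sel pe part) (BadStep⇒PermParts bs)

    partitioned-before-right-calls :
      ∀ {i j r q t t′} {xs xs₁ xs₂ xs₃ xs₄ : List A} → CallInv i j xs →
      PivotSel i j xs xs₁ q → PartRight i j q xs₁ xs₂ r → BadStep i r j xs₂ t t′ xs₃ →
      Step6Cont i r j xs₁ xs₂ xs₃ xs₄ → Partitioned (_≺ q) (q ≼_) i r j q xs₄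
    partitioned-before-right-calls I sel part bs s6 =
      Partitioned-PermParts (Partitioned-PermParts (partition-right I sel part) (BadStep⇒PermParts bs))
                            (Step6Cont⇒PermParts s6)

    CallInv-lower-of-right : ∀ {i r j q} {l : List A} → Partitioned (_≺ q) (q ≼_) i r j q l → CallInv i r l
    CallInv-lower-of-right {i} {r} {j} {q} {l} P = record
      { i≤j           = i≤r P
      ; perm-x₀       = perm-x₀ I
      ; sorted-prefix = sorted-prefix I
      ; prefix≼range  = λ k k<i e → AllIn-narrow {l = l} ≤-refl (<⇒≤ (r<j P)) (prefix≼range I k k<i e)
      ; range≺suffix  = suffix }
      where
      I = inv P
      suffix : AllFrom (λ y → AllIn (λ z → ¬ ¬ z ≺ y) i r l) r l
      suffix k r≤k e k′ i≤k′ k′<r e′ with k ≟ r | j ≤? k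
      ... | yes refl | _       = λ z⊀y → z⊀y (subst (_ ≺_) (‼-unique l k (pivot-at P) e) (lower P k′ i≤k′ k′<r e′))
      ... | no _     | yes j≤k = range≺suffix I k j≤k e k′ i≤k′ (<-trans k′<r (r<j P)) e′
      ... | no k≢r   | no j≰k  = λ z⊀y →
        ≺-cotrans (lower P k′ i≤k′ k′<r e′) z⊀y (upper P k (≤∧≢⇒< r≤k (≢-sym k≢r)) (≰⇒> j≰k) e)

    CallInv-upper-part : ∀ {Lo Hi i r j q} {l : List A} → (∀ {x} → Lo x → x ≼ q) → (∀ {y} → Hi y → q ≼ y) →
                         Partitioned Lo Hi i r j q l → SortedIn i r l → CallInv (suc r) j l
    CallInv-upper-part {Lo} {Hi} {i} {r} {j} {q} {l} lo≼q q≼hi P sorted = record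
      { i≤j           = r<j P
      ; perm-x₀       = perm-x₀ I
      ; sorted-prefix = sorted-prefix′
      ; prefix≼range  = prefix≼range′
      ; range≺suffix  = λ k j≤k e → AllIn-narrow {l = l} (≤-trans (i≤r P) (n≤1+n r)) ≤-refl (range≺suffix I k j≤k e) }
      where
      I = inv P
      ≼q : ∀ k {x} → i ≤ k → k ≤ r → l ‼ k ≡ just x → x ≼ q
      ≼q k i≤k k≤r e with k ≟ r
      ... | yes refl = subst (_≼ q) (‼-unique l k (pivot-at P) e) ≺-irrefl
      ... | no k≢r   = lo≼q (lower P k i≤k (≤∧≢⇒< k≤r k≢r) e)
      sorted-prefix′ : SortedIn 0 (suc r) l
      sorted-prefix′ k k′ _ k<k′ (s≤s k′≤r) e e′ with k′ <? i | k <? i | k′ ≟ r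
      ... | yes k′<i | _       | _        = sorted-prefix I k k′ z≤n k<k′ k′<i e e′
      ... | no k′≮i  | yes k<i | _        = prefix≼range I k k<i e k′ (≮⇒≥ k′≮i) (≤-<-trans k′≤r (r<j P)) e′
      ... | no _     | no k≮i  | yes refl =
        subst (_ ≼_) (‼-unique l k′ (pivot-at P) e′) (≼q k (≮⇒≥ k≮i) (<⇒≤ k<k′) e)
      ... | no _     | no k≮i  | no k′≢r  = sorted k k′ (≮⇒≥ k≮i) k<k′ (≤∧≢⇒< k′≤r k′≢r) e e′
      prefix≼range′ : AllBelow (λ x → AllIn (x ≼_) (suc r) j l) (suc r) l
      prefix≼range′ k (s≤s k≤r) e k′ r<k′ k′<j e′ with k <? i
      ... | yes k<i = prefix≼range I k k<i e k′ (≤-trans (≤-trans (i≤r P) (n≤1+n r)) r<k′) k′<j e′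
      ... | no k≮i  = ≼-trans (≼q k (≮⇒≥ k≮i) k≤r e) (q≼hi (upper P k′ r<k′ k′<j e′))

    CallInv-upper-of-right : ∀ {i r j q} {l : List A} → Partitioned (_≺ q) (q ≼_) i r j q l → SortedIn i r l →
                             CallInv (suc r) j l
    CallInv-upper-of-right = CallInv-upper-part ≺-asym (λ q≼y → q≼y)

    CallInv-upper-of-left : ∀ {i r j q} {l : List A} → Partitioned (_≈ q) (q ≺_) i r j q l → CallInv (suc r) j l
    CallInv-upper-of-left {l = l} P =
      CallInv-upper-part (λ x≈q → proj₂ x≈q) (λ q≺y → ≺-asym q≺y) P (≈-SortedIn {l = l} (lower P))

    CallInv-upper-after-lower-call : ∀ {t i r j q₀ tr₁} {xs zs : List A} → Partitioned (_≺ q₀) (q₀ ≼_) i r j q₀ xs →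
                                     Exec t i r xs zs tr₁ → CallInv (suc r) j zs

    Exec-sorts : ∀ {t i j tr} {xs ys : List A} → Exec t i j xs ys tr → CallInv i j xs → SortedIn i j ys
    Exec-sorts {ys = ys} (ins _ (_ , sorted))  _ = Sorted⇒SortedIn ys sorted
    Exec-sorts {ys = ys} (heap _ (_ , sorted)) _ = Sorted⇒SortedIn ys sorted
    Exec-sorts {ys = ys} (left _ sel pe part bs ex) I =
      SortedIn-from-0 ys (SortedIn-join (CallInv-Shuffle I′ (Exec-Shuffle ex (i≤j I′))) (Exec-sorts ex I′))
      where I′ = CallInv-upper-of-left (partitioned-before-left-call I sel pe part bs)
    Exec-sorts {ys = ys} (rightDone _ sel _ part _ _ π sorted₁ sorted₂) I =
      SortedIn-from-0 ys (SortedIn-join (CallInv-upper-of-right P (Sorted⇒SortedIn ys sorted₁)) (Sorted⇒SortedIn ys sorted₂))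
      where P = Partitioned-PermParts (partition-right I sel part) π
    Exec-sorts {ys = ys} (rightRec _ sel _ part bs s6 ex₁ ex₂) I =
      SortedIn-from-0 ys (SortedIn-join (CallInv-Shuffle I′ (Exec-Shuffle ex₂ (i≤j I′))) (Exec-sorts ex₂ I′))
      where I′ = CallInv-upper-after-lower-call (partitioned-before-right-calls I sel part bs s6) ex₁

    CallInv-upper-after-lower-call P ex =
      CallInv-upper-of-right (Partitioned-Shuffle-lower P (Exec-Shuffle ex (i≤r P))) (Exec-sorts ex (CallInv-lower-of-right P))

    Partitioned⇒Settled : ∀ {i r j q} {l : List A} → Partitioned (_≈ q) (q ≺_) i r j q l → Settled q i r l
    Partitioned⇒Settled {i} {r} {j} {q} {l} P = record
      { sorted-below = sorted-prefix (inv P)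
      ; below≼       = λ k k<i e → prefix≼range (inv P) k k<i e r (i≤r P) (r<j P) (pivot-at P)
      ; block≈       = block
      ; above≻       = above }
      where
      block : AllIn (_≈ q) i (suc r) l
      block k i≤k (s≤s k≤r) e with k ≟ r
      ... | yes refl = subst (_≈ q) (‼-unique l k (pivot-at P) e) ≈-refl
      ... | no k≢r   = lower P k i≤k (≤∧≢⇒< k≤r k≢r) e
      above : AllFrom (λ x → ¬ ¬ q ≺ x) (suc r) l
      above k r<k e with k <? j
      ... | yes k<j = λ q⊀x → q⊀x (upper P k r<k k<j e)
      ... | no k≮j  = range≺suffix (inv P) k (≮⇒≥ k≮j) e r (i≤r P) (r<j P) (pivot-at P)

    module _ (v : A) where

      -- an element ≈ v already sits in the sorted prefix, so it is ≼ the
      -- predecessor while the pivot q ≈ v is ≽ it: they compare equal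
      seen⇒PredEq : ∀ {i j q} {xs xs₁ : List A} → CallInv i j xs → c < j ∸ i →
                    PivotSel i j xs xs₁ q → q ≈ v → SeenBelow v i xs → PredEq i xs₁ q
      seen⇒PredEq {suc i′} {q = q} {xs} {xs₁} I c< sel@(_ , _ , q-at) q≈v (k , s≤s k≤i′ , x , x-at , x≈v)
        with d , d-at₁ ← <⇒‼ xs₁ i′ (<-trans ≤-refl (‼⇒< xs₁ (suc i′) q-at)) =
        i′ , refl , d , d-at₁ , d⊀q , q⊀d
        where
        d-at : xs ‼ i′ ≡ just d
        d-at = trans (sym (fixes-below (PivotSel⇒Shuffle (i≤j I) sel) i′ ≤-refl)) d-at₁
        q⊀d : ¬ q ≺ d
        q⊀d with kq , i≤kq , kq<j , e ← PivotSel⇒OccursIn c< sel = prefix≼range I i′ ≤-refl d-at kq i≤kq kq<j e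
        x≼d : x ≼ d
        x≼d = SortedIn⇒≼ xs (sorted-prefix I) k i′ z≤n k≤i′ ≤-refl x-at d-at
        d⊀q : ¬ d ≺ q
        d⊀q d≺q = ≺-cotrans d≺q x≼d (proj₁ (≈-trans x≈v (≈-sym q≈v)))

      lower-pivot⇒upper-Free : ∀ {t i r j q₀ tr₁} {xs zs : List A} → Partitioned (_≺ q₀) (q₀ ≼_) i r j q₀ xs →
                               Exec t i r xs zs tr₁ → PivotEqIn v tr₁ → Free v (suc r) j zs
      lower-pivot⇒upper-Free {zs = zs} P ex (q , _ , ∈tr₁ , q≈v)
        with k , i≤k , k<r , q-at ← All.lookup (Exec-EventsWithin ex (i≤r P)) ∈tr₁ =
        above-≈-Free v {l = zs} q≈v (AllIn-map {l = zs} (λ q₀≼y q⊀y → ≺-cotrans (lower P k i≤k k<r q-at) q⊀y q₀≼y)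
                                               (upper (Partitioned-Shuffle-lower P (Exec-Shuffle ex (i≤r P)))))

      record Final (arr : List A) (post : List Event) : Set (a ⊔ ℓ) where
        constructor _,_
        field
          final-positions : InFinalPositions v x₀ arr
          avoided         : All (AvoidsV v) post

      Final-++ : ∀ {arr post tr} → Final arr post → All (AvoidsV v) tr → Final arr (post ++ tr)
      Final-++ (final , avoided) avoided′ = final , All++⁺ avoided avoided′

      pivot-after-seen⇒Final : ∀ {t i j tr q arr post} {xs ys : List A} → Exec t i j xs ys tr → CallInv i j xs →
                               SeenBelow v i xs → IsFirstPivot v tr q arr post → Final arr post
      pivot-after-seen⇒Final (ins _ _)  _ _ (there _ ())
      pivot-after-seen⇒Final (heap _ _) _ _ (there _ ())
      pivot-after-seen⇒Final {arr = arr} (left {xs₃ = xs₃} _ sel pe part bs ex) I _ (there _ (here q≈v)) =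
          InFinalPositions-resp-≈ {arr = arr} q≈v (Settled⇒InFinalPositions (Partitioned⇒Settled P₂) (perm-x₀ (inv P₂)))
        , Exec-AvoidsV v ex (r<j P) (above-≈-Free v {l = xs₃} q≈v (AllIn-map {l = xs₃} (λ q≺x q⊀x → q⊀x q≺x) (upper P)))
        where
        P₂ = partition-left I sel pe part
        P  = Partitioned-PermParts P₂ (BadStep⇒PermParts bs)
      pivot-after-seen⇒Final (left _ sel pe part bs ex) I seen (there _ (there _ f)) =
        pivot-after-seen⇒Final ex (CallInv-upper-of-left P)
          (SeenBelow-Shuffle v seen (Shuffle-before-left-call sel part bs) (≤-trans (i≤r P) (n≤1+n _))) f
        where P = partitioned-before-left-call I sel pe part bs
      pivot-after-seen⇒Final (rightDone c< sel ¬pe _ _ _ _ _ _) I seen (there _ (here q≈v)) =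
        ⊥-elim (¬pe (seen⇒PredEq I c< sel q≈v seen))
      pivot-after-seen⇒Final (rightDone _ _ _ _ _ _ _ _ _) _ _ (there _ (there _ ()))
      pivot-after-seen⇒Final (rightRec c< sel ¬pe _ _ _ _ _) I seen (there _ (here q≈v)) =
        ⊥-elim (¬pe (seen⇒PredEq I c< sel q≈v seen))
      pivot-after-seen⇒Final {arr = arr} (rightRec {tr₁ = tr₁} _ sel _ part bs s6 ex₁ ex₂) I seen (there _ (there _ f)) =
        IsFirstPivot-++-elim v tr₁ {B = Final arr} f
          (λ f₁ → Final-++ (pivot-after-seen⇒Final ex₁ (CallInv-lower-of-right P) seen₄ f₁)
                           (Exec-AvoidsV v ex₂ (r<j P) (lower-pivot⇒upper-Free P ex₁ (IsFirstPivot⇒PivotEqIn v f₁))))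
          (λ _ f₂ → pivot-after-seen⇒Final ex₂ (CallInv-upper-after-lower-call P ex₁)
                      (SeenBelow-Shuffle v seen₄ (Exec-Shuffle ex₁ (i≤r P)) (≤-trans (i≤r P) (n≤1+n _))) f₂)
        where
        P     = partitioned-before-right-calls I sel part bs s6
        seen₄ = SeenBelow-Shuffle v seen (Shuffle-before-right-calls sel part bs s6) ≤-refl

      second-pivot⇒Final : ∀ {t i j tr q arr post} {xs ys : List A} → Exec t i j xs ys tr → CallInv i j xs →
                           IsSecondPivot v tr q arr post → Final arr post
      second-pivot⇒Final (ins _ _)  _ (skip _ ())
      second-pivot⇒Final (heap _ _) _ (skip _ ())
      second-pivot⇒Final (left {r = r} _ sel pe part bs ex) I (skip _ (first q≈v f)) =
        pivot-after-seen⇒Final ex (CallInv-upper-of-left P) (r , ≤-refl , _ , pivot-at P , q≈v) f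
        where P = partitioned-before-left-call I sel pe part bs
      second-pivot⇒Final (left _ sel pe part bs ex) I (skip _ (skip _ t)) =
        second-pivot⇒Final ex (CallInv-upper-of-left (partitioned-before-left-call I sel pe part bs)) t
      second-pivot⇒Final (rightDone _ _ _ _ _ _ _ _ _) _ (skip _ (first _ ()))
      second-pivot⇒Final (rightDone _ _ _ _ _ _ _ _ _) _ (skip _ (skip _ ()))
      second-pivot⇒Final {arr = arr} (rightRec {r = r} {xs₄ = xs₄} {tr₁ = tr₁} _ sel _ part bs s6 ex₁ ex₂) I (skip _ (first q₀≈v f)) =
        IsFirstPivot-++-elim v tr₁ {B = Final arr} f
          (λ f₁ → ⊥-elim (NoPivotEq-¬PivotEqIn v (Exec-NoPivotEq v ex₁ (i≤r P) (below-≈-Free v {l = xs₄} q₀≈v (lower P))) (IsFirstPivot⇒PivotEqIn v f₁)))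
          (λ _ f₂ → pivot-after-seen⇒Final ex₂ (CallInv-upper-after-lower-call P ex₁)
                      (r , ≤-refl , _ , pivot-at (Partitioned-Shuffle-lower P (Exec-Shuffle ex₁ (i≤r P))) , q₀≈v) f₂)
        where
        P = partitioned-before-right-calls I sel part bs s6
      second-pivot⇒Final {arr = arr} (rightRec {tr₁ = tr₁} _ sel _ part bs s6 ex₁ ex₂) I (skip _ (skip _ t)) =
        IsSecondPivot-++-elim v tr₁ {B = Final arr} t
          (λ t₁ → Final-++ (second-pivot⇒Final ex₁ (CallInv-lower-of-right P) t₁)
                           (Exec-AvoidsV v ex₂ (r<j P) (lower-pivot⇒upper-Free P ex₁ (IsSecondPivot⇒PivotEqIn v t₁))))
          (λ f₁ f₂ → ⊥-elim (NoPivotEq-¬PivotEqIn v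
                       (Exec-NoPivotEq v ex₂ (r<j P) (lower-pivot⇒upper-Free P ex₁ (IsFirstPivot⇒PivotEqIn v f₁)))
                       (IsFirstPivot⇒PivotEqIn v f₂)))
          (λ _ t₂ → second-pivot⇒Final ex₂ (CallInv-upper-after-lower-call P ex₁) t₂)
        where
        P = partitioned-before-right-calls I sel part bs s6

lemma4 : ∀ {a ℓ} (S : Setting a ℓ) → let open Semantics S in
         ∀ (xs ys : List (Setting.A S)) (tr : List Event) → Run xs ys tr →
         ∀ (v : Setting.A S) (pre : List Event) (q : Setting.A S) (arr : List (Setting.A S)) (post : List Event) →
         SecondPivot v tr pre q arr post →
         InFinalPositions v xs arr × All (AvoidsV v) post
lemma4 S xs ys tr run v pre q arr post (refl , q≈v , pre₁ , pre₂ , q′ , arr′ , refl , q′≈v , none₁ , none₂) =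
  let final , avoided = second-pivot⇒Final xs v run (CallInv-initial xs) (IsSecondPivot-after v none₁ q′≈v none₂ q≈v)
  in  final , avoided
  where open Pdq S
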